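{- Let $n\ge2$ and let $f$ be a nested canalyzing function written in its unique form $f=M_1(M_2(\cdots(M_{r-1}(M_r\oplus1)\oplus1)\cdots)\oplus1)\oplus b$ with $M_i=\prod_{j=1}^{k_i}(x_{i_j}\oplus a_{i_j})$. Then $f$ is monotone (increasing or decreasing) if and only if there is $a\in\{0,1\}$ such that for every odd $i$, $M_i=\prod_{j=1}^{k_i}(x_{i_j}\oplus a)$, and for every even $i$, $M_i=\prod_{j=1}^{k_i}(x_{i_j}\oplus\overline{a})$ (that is, $a_{i_j}=a$ for all variables in odd layers and $a_{i_j}=\overline{a}$ for all variables in even layers).
   Context: Work over $\mathbb{F}_2$, $\oplus$ is addition mod 2, $\overline{a}=a\oplus1$. A Boolean function $f:\mathbb{F}_2^n\to\mathbb{F}_2$ is nested canalyzing if there exist a permutation $\sigma$ of $\{1,\dots,n\}$ and $a_1,\dots,a_n,b_1,\dots,b_n\in\mathbb{F}_2$ such that $f=b_1$ when $x_{\sigma(1)}=a_1$; $f=b_k$ when $x_{\sigma(j)}=\overline{a_j}$ for $j<k$ and $x_{\sigma(k)}=a_k$ ($k=2,\dots,n$); and $f=\overline{b_n}$ when $x_{\sigma(j)}=\overline{a_j}$ for all $j$. It is known that for $n\ge2$ every such $f$ can be written uniquely as $f=M_1(M_2(\cdots(M_{r-1}(M_r\oplus1)\oplus1)\cdots)\oplus1)\oplus b$ with $M_i=\prod_{j=1}^{k_i}(x_{i_j}\oplus a_{i_j})$, $k_i\ge1$ for $i<r$, $k_r\ge2$, $k_1+\dots+k_r=n$, $a_{i_j},b\in\mathbb{F}_2$,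 the $x_{i_j}$ being $x_1,\dots,x_n$ each exactly once. For $\mathbf{x},\mathbf{y}\in\mathbb{F}_2^n$, $\mathbf{x}\prec\mathbf{y}$ means $x_i\le y_i$ for all $i$; $f$ is monotone increasing (resp. decreasing) if $f(\mathbf{x})\le f(\mathbf{y})$ (resp. $\ge$) whenever $\mathbf{x}\prec\mathbf{y}$. -}

module Defs where

open import Data.Bool using (Bool; true; false; not; _∧_; _xor_; _≤_)
open import Data.Nat using (ℕ; zero; suc; _%_) renaming (_≤_ to _≤ℕ_)
open import Data.Fin using (Fin; toℕ)
open import Data.List using (List; []; _∷_; foldr; length; concat; allFin)
open import Data.List.Relation.Unary.All using (All)
open import Data.List.Membership.Propositional using (_∈_)
open import Data.List.Relation.Binary.Permutation.Propositional using (_↭_)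
open import Data.Vec using (Vec; []; _∷_; toList; last; lookup)
open import Data.Product using (_×_)
open import Data.Sum using (_⊎_)
open import Relation.Binary.PropositionalEquality using (_≡_)

-- Points of F_2^n are functions Fin n → Bool (false = 0, true = 1).
-- Addition mod 2 is _xor_, multiplication is _∧_.

-- The layer monomial  M = ∏_{v ∈ layer} (x_v ⊕ a_v),
-- where a : Fin n → Bool assigns to each variable its bit a_{i_j}.
monomial : ∀ {n} → (a : Fin n → Bool) → List (Fin n) → (Fin n → Bool) → Bool
monomial a layer x = foldr (λ v acc → (x v xor a v) ∧ acc) true layer

nest : ∀ {n r} → (a : Fin n → Bool) → Vec (List (Fin n)) (suc r) → (Fin n → Bool) → Bool
nest a (M ∷ []) x = monomial a M x xor true
nest a (M ∷ M' ∷ Ms) x = (monomial a M x ∧ nest a (M' ∷ Ms) x) xor true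

-- f = M_1(M_2(⋯(M_{r-1}(M_r ⊕ 1) ⊕ 1)⋯) ⊕ 1) ⊕ b
-- (for r = 1 this is M_1 ⊕ b).
ncfForm : ∀ {n r} → Vec (List (Fin n)) (suc r) → (a : Fin n → Bool) → (b : Bool)
        → (Fin n → Bool) → Bool
ncfForm L a b x = (nest a L x xor true) xor b

-- Side conditions of the unique form: every layer has k_i ≥ 1, the last layer
-- has k_r ≥ 2, and the layers together contain each of x_1,…,x_n exactly once.
NonEmpty : ∀ {A : Set} → List A → Set
NonEmpty xs = 1 ≤ℕ length xs

ValidLayers : ∀ {n r} → Vec (List (Fin n)) (suc r) → Set
ValidLayers {n} L =
  All NonEmpty (toList L) × (2 ≤ℕ length (last L)) × (concat (toList L) ↭ allFin n)

_≺_ : ∀ {n} → (Fin n → Bool) → (Fin n → Bool) → Set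
x ≺ y = ∀ i → x i ≤ y i

MonotoneIncreasing : ∀ {n} → ((Fin n → Bool) → Bool) → Set
MonotoneIncreasing f = ∀ x y → x ≺ y → f x ≤ f y

MonotoneDecreasing : ∀ {n} → ((Fin n → Bool) → Bool) → Set
MonotoneDecreasing f = ∀ x y → x ≺ y → f y ≤ f x

Monotone : ∀ {n} → ((Fin n → Bool) → Bool) → Set
Monotone f = MonotoneIncreasing f ⊎ MonotoneDecreasing f

-- Layer i (1-based index suc (toℕ i)): if i is odd, all a_{i_j} = c;
-- if i is even, all a_{i_j} = not c.
Alternating : ∀ {n r} → Vec (List (Fin n)) (suc r) → (a : Fin n → Bool) → Bool → Set
Alternating L a c =
  ∀ i → (suc (toℕ i) % 2 ≡ 1 → ∀ v → v ∈ lookup L i → a v ≡ c)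
      × (suc (toℕ i) % 2 ≡ 0 → ∀ v → v ∈ lookup L i → a v ≡ not c)

module Submission where

-- A Boolean function h has polarity d if it is increasing (d = 0) or
-- decreasing (d = 1).  Polarities compose: a conjunction of two functions of
-- polarity d has polarity d, and adding a constant e shifts the polarity by e.
--
-- (⇐) The literal x_v ⊕ a_v has polarity a_v, so a layer monomial all of whose
--     bits equal c has polarity c.  If layer i has bit (i odd) ⊕ c, induction
--     over the layers shows that the nested form, and hence f, has a polarity.
-- (⇒) Fix v in layer i and evaluate f at two "probe" points that differ only
--     at v: the literals of the earlier layers and of the rest of layer i are
--     1, all later literals are 0 (layers are disjoint and non-empty).  There
--     f = x_v ⊕ a_v ⊕ (i odd) ⊕ b, so a polarity d of f forces
--     a_v = (i odd) ⊕ b ⊕ d, the same constant c = b ⊕ d for every layer.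

open import Defs
open import Data.Bool using (Bool; true; false; not; _∧_; _xor_; _≤_; b≤b; f≤t)
open import Data.Bool.Properties
  using (≤-refl; ≤-minimum; not-involutive; xor-comm; xor-assoc; xor-identityʳ; xor-same;
         xor-inverseˡ; ∧-zeroʳ; ∧-identityʳ; not-distribˡ-xor; not-distribʳ-xor)
open import Data.Nat using (ℕ; zero; suc; _%_) renaming (_≤_ to _≤ℕ_)
open import Data.Fin using (Fin; zero; suc; toℕ)
open import Data.Fin.Properties using (_≟_)
open import Data.List using (List; []; _∷_; _++_; concat)
open import Data.List.Properties using (++-assoc)
open import Data.List.Membership.Propositional using (_∈_; _∉_)
open import Data.List.Membership.Propositional.Properties using (∈-++⁺ˡ; ∈-++⁺ʳ; ∈-++⁻)
open import Data.List.Relation.Unary.Any using (here; there)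
open import Data.List.Relation.Unary.All using (All; _∷_; tabulate) renaming (lookup to All-lookup)
open import Data.List.Relation.Unary.AllPairs using (_∷_)
open import Data.List.Relation.Unary.Unique.Propositional using (Unique)
open import Data.List.Relation.Unary.Unique.Propositional.Properties using (allFin⁺)
open import Data.List.Relation.Binary.Permutation.Propositional using (↭-sym; ↭⇒↭ₛ)
import Data.List.Relation.Binary.Permutation.Setoid.Properties as SetoidPermutation
open import Data.Vec using (Vec; []; _∷_; toList; lookup)
open import Data.Product using (∃; _×_; _,_; proj₁; proj₂)
open import Data.Sum using (_⊎_; inj₁; inj₂)
open import Data.Unit using (⊤; tt)
open import Data.Empty using (⊥-elim)
open import Relation.Nullary using (yes; no)
open import Relation.Binary.PropositionalEquality
  using (_≡_; _≢_; refl; sym; trans; cong; subst; subst₂; setoid; module ≡-Reasoning)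
open import Function.Bundles using (_⇔_; mk⇔)

-- Bool's xor computes on its first argument only; this is the other side.
xor-true : ∀ p → p xor true ≡ not p
xor-true p = xor-comm p true

not-antitone : ∀ {p q} → p ≤ q → not q ≤ not p
not-antitone b≤b = b≤b
not-antitone f≤t = f≤t

∧-monotone : ∀ {p q p′ q′} → p ≤ q → p′ ≤ q′ → p ∧ p′ ≤ q ∧ q′
∧-monotone f≤t _ = ≤-minimum _
∧-monotone {false} b≤b _ = b≤b
∧-monotone {true} b≤b le = le

Directed : Bool → Bool → Bool → Set
Directed false p q = p ≤ q
Directed true p q = q ≤ p

directed-refl : ∀ d p → Directed d p p
directed-refl false p = ≤-refl
directed-refl true p = ≤-refl

directed-∧ : ∀ d {p q p′ q′} → Directed d p q → Directed d p′ q′ → Directed d (p ∧ p′) (q ∧ q′)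
directed-∧ false = ∧-monotone
directed-∧ true = ∧-monotone

directed-not : ∀ d {p q} → Directed d p q → Directed (not d) (not p) (not q)
directed-not false = not-antitone
directed-not true = not-antitone

directed-xor : ∀ d e {p q} → Directed d p q → Directed (d xor e) (p xor e) (q xor e)
directed-xor d false {p} {q} le
  rewrite xor-identityʳ d | xor-identityʳ p | xor-identityʳ q = le
directed-xor d true {p} {q} le
  rewrite xor-true d | xor-true p | xor-true q = directed-not d le

-- The map t ↦ t ⊕ s goes in direction d only if s = d.
direction-forced : ∀ d s → Directed d s (not s) → s ≡ d
direction-forced false false _ = refl
direction-forced false true ()
direction-forced true false ()
direction-forced true true _ = refl

xor-transpose : ∀ x y {d} → x xor y ≡ d → x ≡ y xor d
xor-transpose false false refl = refl
xor-transpose false true refl = refl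
xor-transpose true false refl = refl
xor-transpose true true refl = refl

-- Normal form of f at a probe point, as a function of the probed value t.
exit-value : ∀ t s p b → ((((t xor s) xor true) xor p) xor true) xor b ≡ t xor (s xor (p xor b))
exit-value false false false false = refl
exit-value false false false true = refl
exit-value false false true false = refl
exit-value false false true true = refl
exit-value false true false false = refl
exit-value false true false true = refl
exit-value false true true false = refl
exit-value false true true true = refl
exit-value true false false false = refl
exit-value true false false true = refl
exit-value true false true false = refl
exit-value true false true true = refl
exit-value true true false false = refl
exit-value true true false true = refl
exit-value true true true false = refl
exit-value true true true true = refl

isOdd : ℕ → Bool
isOdd zero = false
isOdd (suc k) = not (isOdd k)

layer-parity : ∀ k → (isOdd k ≡ false × suc k % 2 ≡ 1) ⊎ (isOdd k ≡ true × suc k % 2 ≡ 0)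
layer-parity zero = inj₁ (refl , refl)
layer-parity (suc zero) = inj₂ (refl , refl)
layer-parity (suc (suc k)) with layer-parity k
... | inj₁ (even , h) = inj₁ (trans (not-involutive (isOdd k)) even , h)
... | inj₂ (odd , h) = inj₂ (trans (not-involutive (isOdd k)) odd , h)

odd-layer : ∀ k → suc k % 2 ≡ 1 → isOdd k ≡ false
odd-layer k h with layer-parity k
... | inj₁ (even , _) = even
... | inj₂ (_ , h′) with trans (sym h) h′
... | ()

even-layer : ∀ k → suc k % 2 ≡ 0 → isOdd k ≡ true
even-layer k h with layer-parity k
... | inj₂ (odd , _) = odd
... | inj₁ (_ , h′) with trans (sym h) h′
... | ()

unique-disjoint : ∀ {A : Set} (xs : List A) {ys : List A} {u : A}
  → Unique (xs ++ ys) → u ∈ xs → u ∉ ys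
unique-disjoint (x ∷ xs) (x∉rest ∷ _) (here refl) u∈ys = All-lookup x∉rest (∈-++⁺ʳ xs u∈ys) refl
unique-disjoint (x ∷ xs) (_ ∷ unique) (there u∈xs) u∈ys = unique-disjoint xs unique u∈xs u∈ys

unique-++ʳ : ∀ {A : Set} (xs : List A) {ys : List A} → Unique (xs ++ ys) → Unique ys
unique-++ʳ [] unique = unique
unique-++ʳ (x ∷ xs) (_ ∷ unique) = unique-++ʳ xs unique

module _ {A : Set} where

  before : ∀ {m} → Vec (List A) m → Fin m → List A
  before (M ∷ Ms) zero = []
  before (M ∷ Ms) (suc i) = M ++ before Ms i

  after : ∀ {m} → Vec (List A) m → Fin m → List A
  after (M ∷ Ms) zero = concat (toList Ms)
  after (M ∷ Ms) (suc i) = after Ms i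

  concat-split : ∀ {m} (L : Vec (List A) m) i
    → concat (toList L) ≡ before L i ++ lookup L i ++ after L i
  concat-split (M ∷ Ms) zero = refl
  concat-split (M ∷ Ms) (suc i) = begin
    M ++ concat (toList Ms)                          ≡⟨ cong (M ++_) (concat-split Ms i) ⟩
    M ++ before Ms i ++ lookup Ms i ++ after Ms i    ≡⟨ sym (++-assoc M (before Ms i) _) ⟩
    (M ++ before Ms i) ++ lookup Ms i ++ after Ms i  ∎
    where open ≡-Reasoning

MonotoneIn : ∀ {n} → Bool → ((Fin n → Bool) → Bool) → Set
MonotoneIn d h = ∀ x y → x ≺ y → Directed d (h x) (h y)

monotoneIn⇒monotone : ∀ {n} d {h : (Fin n → Bool) → Bool} → MonotoneIn d h → Monotone h
monotoneIn⇒monotone false mono = inj₁ mono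
monotoneIn⇒monotone true mono = inj₂ mono

monotone⇒monotoneIn : ∀ {n} {h : (Fin n → Bool) → Bool} → Monotone h → ∃ λ d → MonotoneIn d h
monotone⇒monotoneIn (inj₁ increasing) = false , increasing
monotone⇒monotoneIn (inj₂ decreasing) = true , decreasing

monotoneIn-cong : ∀ {n d} {g h : (Fin n → Bool) → Bool}
  → (∀ x → g x ≡ h x) → MonotoneIn d h → MonotoneIn d g
monotoneIn-cong {d = d} g≡h mono x y x≺y =
  subst₂ (Directed d) (sym (g≡h x)) (sym (g≡h y)) (mono x y x≺y)

monotone-∧ : ∀ {n d} {g h : (Fin n → Bool) → Bool}
  → MonotoneIn d g → MonotoneIn d h → MonotoneIn d (λ x → g x ∧ h x)
monotone-∧ {d = d} mono-g mono-h x y x≺y = directed-∧ d (mono-g x y x≺y) (mono-h x y x≺y)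

monotone-xor : ∀ {n d} {h : (Fin n → Bool) → Bool} e
  → MonotoneIn d h → MonotoneIn (d xor e) (λ x → h x xor e)
monotone-xor {d = d} e mono x y x≺y = directed-xor d e (mono x y x≺y)

module NestedForm {n : ℕ} (a : Fin n → Bool) where

  open import Data.List.Membership.DecPropositional (_≟_ {n}) using (_∈?_)
  open ≡-Reasoning

  Point : Set
  Point = Fin n → Bool

  Layers : ℕ → Set
  Layers r = Vec (List (Fin n)) r

  lit : Point → Fin n → Bool
  lit x v = x v xor a v

  LayerPolarity : ∀ {r} → Layers (suc r) → Bool → Set
  LayerPolarity L c = ∀ i v → v ∈ lookup L i → a v ≡ isOdd (toℕ i) xor c

  alternating⇒polarity : ∀ {r} (L : Layers (suc r)) c → Alternating L a c → LayerPolarity L c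
  alternating⇒polarity L c alt i v v∈ with layer-parity (toℕ i)
  ... | inj₁ (even , odd-position) rewrite even = proj₁ (alt i) odd-position v v∈
  ... | inj₂ (odd , even-position) rewrite odd = proj₂ (alt i) even-position v v∈

  polarity⇒alternating : ∀ {r} (L : Layers (suc r)) c → LayerPolarity L c → Alternating L a c
  polarity⇒alternating L c pol i =
      (λ odd-position v v∈ → subst (bit v) (odd-layer (toℕ i) odd-position) (pol i v v∈))
    , (λ even-position v v∈ → subst (bit v) (even-layer (toℕ i) even-position) (pol i v v∈))
    where
      bit : Fin n → Bool → Set
      bit v p = a v ≡ p xor c

  polarity-head : ∀ {r} {M} {Ms : Layers r} {c} → LayerPolarity (M ∷ Ms) c → All (λ v → a v ≡ c) M
  polarity-head pol = tabulate (λ {v} v∈ → pol zero v v∈)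

  polarity-tail : ∀ {r} {M} {Ms : Layers (suc r)} {c} → LayerPolarity (M ∷ Ms) c → LayerPolarity Ms (not c)
  polarity-tail {c = c} pol i v v∈ = begin
    a v                         ≡⟨ pol (suc i) v v∈ ⟩
    not (isOdd (toℕ i)) xor c   ≡⟨ sym (not-distribˡ-xor (isOdd (toℕ i)) c) ⟩
    not (isOdd (toℕ i) xor c)   ≡⟨ not-distribʳ-xor (isOdd (toℕ i)) c ⟩
    isOdd (toℕ i) xor not c     ∎

  monomial-monotone : ∀ c M → All (λ v → a v ≡ c) M → MonotoneIn c (monomial a M)
  monomial-monotone c [] _ x y _ = directed-refl c true
  monomial-monotone c (v ∷ M) (av≡c ∷ bits) = monotone-∧ literal (monomial-monotone c M bits)
    where
      literal : MonotoneIn c (λ x → lit x v)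
      literal x y x≺y =
        subst (λ d → Directed d (lit x v) (lit y v)) av≡c (directed-xor false (a v) (x≺y v))

  nest-monotone : ∀ {r} (L : Layers (suc r)) c → LayerPolarity L c → MonotoneIn (c xor true) (nest a L)
  nest-monotone (M ∷ []) c pol = monotone-xor true (monomial-monotone c M (polarity-head pol))
  nest-monotone (M ∷ M′ ∷ Ms) c pol =
    monotone-xor true (monotone-∧ (monomial-monotone c M (polarity-head pol)) inner)
    where
      inner : MonotoneIn c (nest a (M′ ∷ Ms))
      inner = subst (λ d → MonotoneIn d (nest a (M′ ∷ Ms)))
                    (trans (xor-true (not c)) (not-involutive c))
                    (nest-monotone (M′ ∷ Ms) (not c) (polarity-tail pol))

  ncfForm-monotone : ∀ {r} (L : Layers (suc r)) b c → LayerPolarity L c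
    → ∃ λ d → MonotoneIn d (ncfForm L a b)
  ncfForm-monotone L b c pol = _ , monotone-xor b (monotone-xor true (nest-monotone L c pol))

  monomial-true : ∀ M x → (∀ {u} → u ∈ M → lit x u ≡ true) → monomial a M x ≡ true
  monomial-true [] x _ = refl
  monomial-true (u ∷ M) x all-true rewrite all-true (here refl) =
    monomial-true M x (λ u∈ → all-true (there u∈))

  monomial-false : ∀ M x {u} → u ∈ M → lit x u ≡ false → monomial a M x ≡ false
  monomial-false (u ∷ M) x (here refl) false-lit rewrite false-lit = refl
  monomial-false (w ∷ M) x (there u∈) false-lit =
    trans (cong (lit x w ∧_) (monomial-false M x u∈ false-lit)) (∧-zeroʳ (lit x w))

  monomial-at : ∀ M x {v} → v ∈ M → (∀ {u} → u ∈ M → u ≢ v → lit x u ≡ true)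
    → monomial a M x ≡ lit x v
  monomial-at M x {v} v∈ others with lit x v in lit-v
  ... | false = monomial-false M x v∈ lit-v
  ... | true = monomial-true M x all-true
    where
      all-true : ∀ {u} → u ∈ M → lit x u ≡ true
      all-true {u} u∈ with u ≟ v
      ... | yes refl = lit-v
      ... | no u≢v = others u∈ u≢v

  Stops : ∀ {r} → Layers r → Point → Set
  Stops [] x = ⊤
  Stops (M ∷ _) x = monomial a M x ≡ false

  ExitsAt : ∀ {r} → Layers (suc r) → Fin (suc r) → Point → Set
  ExitsAt (M ∷ Ms) zero x = Stops Ms x
  ExitsAt (M ∷ []) (suc ()) x
  ExitsAt (M ∷ M′ ∷ Ms) (suc i) x = monomial a M x ≡ true × ExitsAt (M′ ∷ Ms) i x

  nest-stops : ∀ {r} (L : Layers (suc r)) x → Stops L x → nest a L x ≡ true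
  nest-stops (M ∷ []) x m≡0 rewrite m≡0 = refl
  nest-stops (M ∷ M′ ∷ Ms) x m≡0 rewrite m≡0 = refl

  -- Exiting at layer i, the nested form is ¬M_i, negated once more per layer passed.
  nest-at-exit : ∀ {r} (L : Layers (suc r)) i x → ExitsAt L i x
    → nest a L x ≡ (monomial a (lookup L i) x xor true) xor isOdd (toℕ i)
  nest-at-exit (M ∷ []) zero x _ = sym (xor-identityʳ _)
  nest-at-exit (M ∷ M′ ∷ Ms) zero x stops
    rewrite nest-stops (M′ ∷ Ms) x stops | ∧-identityʳ (monomial a M x) = sym (xor-identityʳ _)
  nest-at-exit (M ∷ M′ ∷ Ms) (suc i) x (m≡1 , exits) rewrite m≡1 = begin
    nest a (M′ ∷ Ms) x xor true    ≡⟨ cong (_xor true) (nest-at-exit (M′ ∷ Ms) i x exits) ⟩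
    ((mᵢ xor true) xor p) xor true ≡⟨ xor-assoc (mᵢ xor true) p true ⟩
    (mᵢ xor true) xor (p xor true) ≡⟨ cong ((mᵢ xor true) xor_) (xor-true p) ⟩
    (mᵢ xor true) xor not p        ∎
    where
      mᵢ = monomial a (lookup (M′ ∷ Ms) i) x
      p = isOdd (toℕ i)

  exits : ∀ {r} (L : Layers (suc r)) i x → All NonEmpty (toList L)
    → (∀ {u} → u ∈ before L i → lit x u ≡ true)
    → (∀ {u} → u ∈ after L i → lit x u ≡ false)
    → ExitsAt L i x
  exits (M ∷ []) zero x _ _ _ = tt
  exits (M ∷ [] ∷ Ms) zero x (_ ∷ () ∷ _) _ _
  exits (M ∷ (u ∷ M′) ∷ Ms) zero x _ _ later = monomial-false (u ∷ M′) x (here refl) (later (here refl))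
  exits (M ∷ M′ ∷ Ms) (suc i) x (_ ∷ nonempty) earlier later =
      monomial-true M x (λ u∈ → earlier (∈-++⁺ˡ u∈))
    , exits (M′ ∷ Ms) i x nonempty (λ u∈ → earlier (∈-++⁺ʳ M u∈)) later

  -- probe P v t: v takes the value t, the other variables of P make their
  -- literal 1 and all remaining variables make their literal 0.
  probe : List (Fin n) → Fin n → Bool → Point
  probe P v t u with u ∈? P
  ... | no _ = a u
  ... | yes _ with u ≟ v
  ...   | yes _ = t
  ...   | no _ = not (a u)

  probe-in : ∀ P v t {u} → u ∈ P → u ≢ v → lit (probe P v t) u ≡ true
  probe-in P v t {u} u∈P u≢v with u ∈? P
  ... | no u∉P = ⊥-elim (u∉P u∈P)
  ... | yes _ with u ≟ v
  ...   | yes u≡v = ⊥-elim (u≢v u≡v)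
  ...   | no _ = xor-inverseˡ (a u)

  probe-out : ∀ P v t {u} → u ∉ P → lit (probe P v t) u ≡ false
  probe-out P v t {u} u∉P with u ∈? P
  ... | yes u∈P = ⊥-elim (u∉P u∈P)
  ... | no _ = xor-same (a u)

  probe-at : ∀ P v t → v ∈ P → probe P v t v ≡ t
  probe-at P v t v∈P with v ∈? P
  ... | no v∉P = ⊥-elim (v∉P v∈P)
  ... | yes _ with v ≟ v
  ...   | yes _ = refl
  ...   | no v≢v = ⊥-elim (v≢v refl)

  probe-≺ : ∀ P v → probe P v false ≺ probe P v true
  probe-≺ P v u with u ∈? P
  ... | no _ = ≤-refl
  ... | yes _ with u ≟ v
  ...   | yes _ = f≤t
  ...   | no _ = ≤-refl

  nest-at-probe : ∀ {r} (L : Layers (suc r)) → All NonEmpty (toList L) → Unique (concat (toList L))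
    → ∀ i {v} → v ∈ lookup L i → ∀ t
    → nest a L (probe (before L i ++ lookup L i) v t) ≡ ((t xor a v) xor true) xor isOdd (toℕ i)
  nest-at-probe L nonempty unique i {v} v∈ t = begin
    nest a L x                                  ≡⟨ nest-at-exit L i x (exits L i x nonempty earlier later) ⟩
    (monomial a (lookup L i) x xor true) xor p  ≡⟨ cong (λ m → (m xor true) xor p) layer-value ⟩
    ((t xor a v) xor true) xor p                ∎
    where
      P = before L i ++ lookup L i
      x = probe P v t
      p = isOdd (toℕ i)

      split : Unique (before L i ++ lookup L i ++ after L i)
      split = subst Unique (concat-split L i) unique

      earlier : ∀ {u} → u ∈ before L i → lit x u ≡ true
      earlier u∈ = probe-in P v t (∈-++⁺ˡ u∈)
                     (λ { refl → unique-disjoint (before L i) split u∈ (∈-++⁺ˡ v∈) })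

      rest-of-layer : ∀ {u} → u ∈ lookup L i → u ≢ v → lit x u ≡ true
      rest-of-layer u∈ = probe-in P v t (∈-++⁺ʳ (before L i) u∈)

      layer-value : monomial a (lookup L i) x ≡ t xor a v
      layer-value = trans (monomial-at (lookup L i) x v∈ rest-of-layer)
                          (cong (_xor a v) (probe-at P v t (∈-++⁺ʳ (before L i) v∈)))

      later : ∀ {u} → u ∈ after L i → lit x u ≡ false
      later {u} u∈ = probe-out P v t not-in-P
        where
          not-in-P : u ∉ P
          not-in-P u∈P with ∈-++⁻ (before L i) u∈P
          ... | inj₁ u∈before = unique-disjoint (before L i) split u∈before (∈-++⁺ʳ (lookup L i) u∈)
          ... | inj₂ u∈layer = unique-disjoint (lookup L i) (unique-++ʳ (before L i) split) u∈layer u∈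

  polarity-forced : ∀ {r} (L : Layers (suc r)) b (f : Point → Bool) → ValidLayers L
    → (∀ x → f x ≡ ncfForm L a b x) → ∀ d → MonotoneIn d f → LayerPolarity L (b xor d)
  polarity-forced L b f (nonempty , _ , perm) f≡ d mono i v v∈ =
    trans (xor-transpose (a v) (p xor b) bit≡d) (xor-assoc p b d)
    where
      unique : Unique (concat (toList L))
      unique = SetoidPermutation.Unique-resp-↭ (setoid (Fin n)) (↭⇒↭ₛ (↭-sym perm)) (allFin⁺ n)

      P = before L i ++ lookup L i
      p = isOdd (toℕ i)

      value : ∀ t → f (probe P v t) ≡ t xor (a v xor (p xor b))
      value t = begin
        f (probe P v t)                                  ≡⟨ f≡ (probe P v t) ⟩
        (nest a L (probe P v t) xor true) xor b          ≡⟨ cong (λ z → (z xor true) xor b) nest-value ⟩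
        ((((t xor a v) xor true) xor p) xor true) xor b  ≡⟨ exit-value t (a v) p b ⟩
        t xor (a v xor (p xor b))                        ∎
        where nest-value = nest-at-probe L nonempty unique i v∈ t

      bit≡d : a v xor (p xor b) ≡ d
      bit≡d = direction-forced d _
        (subst₂ (Directed d) (value false) (value true) (mono _ _ (probe-≺ P v)))

  monotone-forces-polarity : ∀ {r} (L : Layers (suc r)) b (f : Point → Bool) → ValidLayers L
    → (∀ x → f x ≡ ncfForm L a b x) → Monotone f → ∃ λ c → LayerPolarity L c
  monotone-forces-polarity L b f valid f≡ mono with monotone⇒monotoneIn mono
  ... | d , mono-d = b xor d , polarity-forced L b f valid f≡ d mono-d

theorem4p1 : (n : ℕ) → 2 ≤ℕ n → (r : ℕ) → (L : Vec (List (Fin n)) (suc r))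
    → (a : Fin n → Bool) → (b : Bool) → ValidLayers L
    → (f : (Fin n → Bool) → Bool) → (∀ x → f x ≡ ncfForm L a b x)
    → (Monotone f ⇔ ∃ (λ c → Alternating L a c))
theorem4p1 n _ r L a b valid f f≡ = mk⇔ monotone⇒alternating alternating⇒monotone
  where
    open NestedForm a

    monotone⇒alternating : Monotone f → ∃ (λ c → Alternating L a c)
    monotone⇒alternating mono =
      let (c , pol) = monotone-forces-polarity L b f valid f≡ mono
      in c , polarity⇒alternating L c pol

    alternating⇒monotone : ∃ (λ c → Alternating L a c) → Monotone f
    alternating⇒monotone (c , alt) =
      let (d , mono) = ncfForm-monotone L b c (alternating⇒polarity L c alt)
      in monotoneIn⇒monotone d (monotoneIn-cong f≡ mono)
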